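{- Let $D$ be a directed acyclic graph with vertex set $\{1,\ldots,n\}$. For $1\le x\le y\le n$ let $Cl([x,y])$ be the set of vertices reachable in $D$ (by a directed path, possibly of length $0$) from at least one vertex of $[x,y]=\{x,\ldots,y\}$. Define $x\in potBeg(y)$ iff $x\le y$ and $x\le\min Cl([x,y])$, and $y\in potEnd(x)$ iff $y\ge x$ and $y\ge\max Cl([x,y])$. Then: (1) for every $2\le y\le n$ and all $x<x'$ in $potBeg(y-1)$, if $x'\in potBeg(y)$ then $x\in potBeg(y)$; (2) for all $1\le x\le y\le n$, $[x,y]$ is a closed interval of $D$ if and only if $x\in potBeg(y)$ and $y\in potEnd(x)$.
   Context: A closed interval of $D$ is an integer interval $[x,y]\subseteq\{1,\ldots,n\}$ such that every vertex reachable from some $z\in[x,y]$ lies in $[x,y]$. -}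

module Defs where

open import Level using (0ℓ)
open import Data.Nat using (ℕ; _≤_; _<_; _∸_)
open import Data.Product using (Σ; _×_; ∃)
open import Relation.Nullary using (¬_)
open import Relation.Binary.Construct.Closure.ReflexiveTransitive using (Star)
open import Relation.Binary.Construct.Closure.Transitive using (TransClosure)

record Digraph : Set₁ where
  field
    n      : ℕ
    Edge   : ℕ → ℕ → Set
    edge-src : ∀ {u v} → Edge u v → 1 ≤ u × u ≤ n
    edge-tgt : ∀ {u v} → Edge u v → 1 ≤ v × v ≤ n

Acyclic : Digraph → Set
Acyclic D = ∀ v → ¬ TransClosure (Digraph.Edge D) v v

Reach : (D : Digraph) → ℕ → ℕ → Set
Reach D = Star (Digraph.Edge D)

_∈[_,_] : ℕ → ℕ → ℕ → Set
z ∈[ x , y ] = x ≤ z × z ≤ y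

InCl : (D : Digraph) → ℕ → ℕ → ℕ → Set
InCl D x y v = Σ ℕ λ z → z ∈[ x , y ] × Reach D z v

-- x ∈ potBeg(y): x is a vertex, x ≤ y, and x ≤ min Cl([x,y])
-- (i.e. x is ≤ every element of the nonempty set Cl([x,y])).
potBeg : (D : Digraph) → ℕ → ℕ → Set
potBeg D y x = 1 ≤ x × x ≤ y × (∀ v → InCl D x y v → x ≤ v)

potEnd : (D : Digraph) → ℕ → ℕ → Set
potEnd D x y = y ≤ Digraph.n D × x ≤ y × (∀ v → InCl D x y v → v ≤ y)

ClosedInterval : (D : Digraph) → ℕ → ℕ → Set
ClosedInterval D x y =
  (1 ≤ x × x ≤ y × y ≤ Digraph.n D) ×
  (∀ z v → z ∈[ x , y ] → Reach D z v → v ∈[ x , y ])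

module Submission where

open import Defs
open import Data.Nat using (suc; _≤_; _<_; _∸_)
open import Data.Nat.Properties using (≤-trans; <⇒≤; ≤-pred; m≤n⇒m≤1+n; _≤?_; ≰⇒>)
open import Data.Product using (_×_; _,_; proj₁; proj₂)
open import Data.Sum using (_⊎_; inj₁; inj₂)
open import Function.Bundles using (_⇔_; mk⇔)
open import Relation.Nullary using (yes; no)

module _ (D : Digraph) where

  inCl-split : ∀ {x x′ w y v} → x′ ≤ suc w → InCl D x y v → InCl D x w v ⊎ InCl D x′ y v
  inCl-split {x′ = x′} x′≤1+w (z , (x≤z , z≤y) , z↝v) with x′ ≤? z
  ... | yes x′≤z = inj₂ (z , (x′≤z , z≤y) , z↝v)
  ... | no  x′≰z = inj₁ (z , (x≤z , ≤-pred (≤-trans (≰⇒> x′≰z) x′≤1+w)) , z↝v)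

  -- Cl([x,y]) ⊆ Cl([x,w]) ∪ Cl([x′,y]), and x is a lower bound of both.
  potBeg-extend : ∀ {x x′ w y} → x ≤ x′ → x′ ≤ suc w →
    potBeg D w x → potBeg D y x′ → potBeg D y x
  potBeg-extend x≤x′ x′≤1+w (1≤x , _ , x≤Clw) (_ , x′≤y , x′≤Cl) =
    1≤x , ≤-trans x≤x′ x′≤y , x≤Cl
    where
    x≤Cl : ∀ v → InCl D _ _ v → _ ≤ v
    x≤Cl v v∈Cl with inCl-split x′≤1+w v∈Cl
    ... | inj₁ v∈Clw = x≤Clw v v∈Clw
    ... | inj₂ v∈Cl′ = ≤-trans x≤x′ (x′≤Cl v v∈Cl′)

  closedInterval⇔potBeg×potEnd : ∀ {x y} → 1 ≤ x → x ≤ y → y ≤ Digraph.n D →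
    ClosedInterval D x y ⇔ (potBeg D y x × potEnd D x y)
  closedInterval⇔potBeg×potEnd {x} {y} 1≤x x≤y y≤n = mk⇔ bounds closed
    where
    bounds : ClosedInterval D x y → potBeg D y x × potEnd D x y
    bounds (_ , Cl⊆[x,y]) =
        (1≤x , x≤y , λ v (z , z∈ , z↝v) → proj₁ (Cl⊆[x,y] z v z∈ z↝v))
      , (y≤n , x≤y , λ v (z , z∈ , z↝v) → proj₂ (Cl⊆[x,y] z v z∈ z↝v))

    closed : potBeg D y x × potEnd D x y → ClosedInterval D x y
    closed ((_ , _ , x≤Cl) , (_ , _ , Cl≤y)) =
      (1≤x , x≤y , y≤n) , λ z v z∈ z↝v → x≤Cl v (z , z∈ , z↝v) , Cl≤y v (z , z∈ , z↝v)

mainTheorem8 : (D : Digraph) → Acyclic D →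
    (∀ y x x′ → 2 ≤ y → y ≤ Digraph.n D → x < x′ →
      potBeg D (y ∸ 1) x → potBeg D (y ∸ 1) x′ →
      potBeg D y x′ → potBeg D y x)
    ×
    (∀ x y → 1 ≤ x → x ≤ y → y ≤ Digraph.n D →
      (ClosedInterval D x y ⇔ (potBeg D y x × potEnd D x y)))
mainTheorem8 D _ =
    (λ y x x′ _ _ x<x′ beg-x (_ , x′≤y-1 , _) →
      potBeg-extend D (<⇒≤ x<x′) (m≤n⇒m≤1+n x′≤y-1) beg-x)
  , (λ x y → closedInterval⇔potBeg×potEnd D)
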